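{- Let $q$ be a skeletal quiddity sequence. Then, up to rotating the inner boundary component and its marked points, there is a unique skeletal triangulation of an annulus $C_{m,n}$ (with $m$ the length of $q$ and $n\ge1$) such that the infinite periodic frieze associated to the outer boundary component has $q$ as its quiddity sequence.
   Context: Friezes: given positive integers $(a_i)_{i\in\mathbb{Z}}$, define $a_{i,j}$ ($j\ge i-2$) by $a_{i,i-2}=0$, $a_{i,i-1}=1$, $a_{i,i}=a_i$ and $a_{i,j}a_{i+1,j+1}-a_{i,j+1}a_{i+1,j}=1$; infinite frieze if all $a_{i,j}$ ($j\ge i$) are positive integers, periodic with quiddity sequence $(a_1,\dots,a_m)$ if $a_{i+m}=a_i$; quiddity sequences are up to cyclic rotation. Skeletal quiddity sequence: no entry equals $1$ and not equal to $(2,\dots,2)$. Annuli: $C_{m,n}$ has $m$ marked points on the outer boundary component $B_1$ and $n$ on the inner one $B_2$. Arcs are homotopy classes of curves between marked points with a simple representative meeting the boundary only at endpoints and not contractible into the boundary; a triangulation is a maximal set of pairwise non-crossing arcs (finite arcs only). Peripheral arcs have both endpoints on one boundary component, bridging arcs join different components. A triangulation is skeletal if all its arcs are bridging. The frieze associated to a boundary component of a triangulation is the infinite periodic frieze whose quiddity sequence lists, in cyclic order of the marked points on that component, the number of triangles incident to each marked point. -}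

module Defs where

open import Data.Nat as ℕ using (ℕ; zero; suc)
open import Data.Integer as ℤ using (ℤ; +_; 0ℤ; _%ℕ_)
open import Data.Integer.DivMod using (n%ℕd<d)
open import Data.Fin using (Fin; toℕ; fromℕ<)
open import Data.Vec using (Vec; lookup)
open import Data.List using (List; map)
open import Data.Nat.ListAction using (sum)
open import Data.List.Relation.Unary.All using (All)
open import Data.List.Relation.Unary.Unique.Propositional using (Unique)
open import Data.List.Membership.Propositional using (_∈_)
open import Data.Product using (Σ; _×_)
open import Data.Sum using (_⊎_)
open import Data.Empty using (⊥)
open import Data.Bool using (if_then_else_)
open import Relation.Nullary using (¬_; does)
open import Relation.Binary.PropositionalEquality using (_≡_; _≢_)
open import Function using (_⇔_)

-- We index the entry
-- a_{i,j} (j ≥ i-2) by F i (j - i + 2), so F i 0 = a_{i,i-2} = 0,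
-- F i 1 = a_{i,i-1} = 1, F i 2 = a_{i,i} = a_i, and the unimodular rule
-- a_{i,j} a_{i+1,j+1} - a_{i,j+1} a_{i+1,j} = 1 (for j ≥ i-1) reads as below.
record IsInfiniteFrieze (a : ℤ → ℤ) : Set where
  field
    F        : ℤ → ℕ → ℤ
    row0     : ∀ i → F i 0 ≡ 0ℤ
    row1     : ∀ i → F i 1 ≡ + 1
    row2     : ∀ i → F i 2 ≡ a i
    diamond  : ∀ i k →
      (F i (suc k) ℤ.* F (i ℤ.+ + 1) (suc k))
        ℤ.- (F i (suc (suc k)) ℤ.* F (i ℤ.+ + 1) k) ≡ + 1
    positive : ∀ i k → 0ℤ ℤ.< F i (suc (suc k))

-- periodic extension of a finite sequence (a_1,…,a_m) to ℤ → ℤ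
-- (position i ↦ entry with index i mod m; for m = 0 it is constantly 0)
periodic : ∀ {m} → Vec ℕ m → ℤ → ℤ
periodic {zero}  q i = 0ℤ
periodic {suc m} q i = + lookup q (fromℕ< (n%ℕd<d i (suc m)))

IsQuiddity : ∀ {m} → Vec ℕ m → Set
IsQuiddity q = IsInfiniteFrieze (periodic q)

IsSkeletalQuiddity : ∀ {m} → Vec ℕ m → Set
IsSkeletalQuiddity {m} q =
  IsQuiddity q × (∀ (k : Fin m) → lookup q k ≢ 1) × ¬ (∀ (k : Fin m) → lookup q k ≡ 2)

-- Combinatorial model via the universal cover (a strip): outer marked
-- points lift to ℤ (lift x is outer point x mod m), inner marked points
-- lift to ℤ (lift y is inner point y mod n); the deck transformation is
-- (x , y) ↦ (x + m , y + n).  Each homotopy class of arcs has exactly one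
-- canonical representative below:
--   bridge k l : bridging arc from outer point k (0 ≤ k < m) to the lift
--                l ∈ ℤ of an inner point (l mod n is the inner point; the
--                value of l records the winding);
--   outer a d  : peripheral arc on B₁ from lift a (0 ≤ a < m) to lift a + d,
--                2 ≤ d ≤ m (d = 1 would be a boundary segment, d > m not simple);
--   inner c d  : peripheral arc on B₂, likewise with n.
data Arc : Set where
  bridge : ℕ → ℤ → Arc
  outer  : ℕ → ℕ → Arc
  inner  : ℕ → ℕ → Arc

Valid : ℕ → ℕ → Arc → Set
Valid m n (bridge k l) = k ℕ.< m
Valid m n (outer a d)  = a ℕ.< m × 2 ℕ.≤ d × d ℕ.≤ m
Valid m n (inner c d)  = c ℕ.< n × 2 ℕ.≤ d × d ℕ.≤ n

data Lifted : Set where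
  br : ℤ → ℤ → Lifted   -- outer position, inner position
  op : ℤ → ℤ → Lifted   -- endpoints x < x' on the outer line
  ip : ℤ → ℤ → Lifted   -- endpoints y < y' on the inner line

lift : ℕ → ℕ → ℤ → Arc → Lifted
lift m n t (bridge k l) = br (+ k ℤ.+ t ℤ.* + m) (l ℤ.+ t ℤ.* + n)
lift m n t (outer a d)  = op (+ a ℤ.+ t ℤ.* + m) (+ a ℤ.+ t ℤ.* + m ℤ.+ + d)
lift m n t (inner c d)  = ip (+ c ℤ.+ t ℤ.* + n) (+ c ℤ.+ t ℤ.* + n ℤ.+ + d)

CrossL : Lifted → Lifted → Set
CrossL (br x y) (br x' y') = (x ℤ.< x' × y' ℤ.< y) ⊎ (x' ℤ.< x × y ℤ.< y')
CrossL (br x y) (op a b)   = a ℤ.< x × x ℤ.< b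
CrossL (op a b) (br x y)   = a ℤ.< x × x ℤ.< b
CrossL (br x y) (ip c d)   = c ℤ.< y × y ℤ.< d
CrossL (ip c d) (br x y)   = c ℤ.< y × y ℤ.< d
CrossL (op a b) (op c d)   = (a ℤ.< c × c ℤ.< b × b ℤ.< d) ⊎ (c ℤ.< a × a ℤ.< d × d ℤ.< b)
CrossL (ip a b) (ip c d)   = (a ℤ.< c × c ℤ.< b × b ℤ.< d) ⊎ (c ℤ.< a × a ℤ.< d × d ℤ.< b)
CrossL (op _ _) (ip _ _)   = ⊥
CrossL (ip _ _) (op _ _)   = ⊥

Cross : ℕ → ℕ → Arc → Arc → Set
Cross m n α β = Σ ℤ λ t → CrossL (lift m n 0ℤ α) (lift m n t β)

record IsTriangulation (m n : ℕ) (T : List Arc) : Set where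
  field
    valid       : All (Valid m n) T
    unique      : Unique T
    noncrossing : ∀ {α β} → α ∈ T → β ∈ T → ¬ Cross m n α β
    maximal     : ∀ γ → Valid m n γ → (∀ {α} → α ∈ T → ¬ Cross m n γ α) → γ ∈ T

IsBridging : Arc → Set
IsBridging (bridge _ _) = Data.Unit.⊤ where import Data.Unit
IsBridging (outer _ _)  = ⊥
IsBridging (inner _ _)  = ⊥

IsSkeletalTriangulation : ℕ → ℕ → List Arc → Set
IsSkeletalTriangulation m n T = IsTriangulation m n T × All IsBridging T

modN : ℕ → ℕ → ℕ
modN x zero    = x
modN x (suc m) = x ℕ.% suc m

modZ : ℤ → ℕ → ℕ
modZ i zero    = ℤ.∣ i ∣
modZ i (suc n) = i %ℕ suc n

[_≟_]ℕ : ℕ → ℕ → ℕ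
[ x ≟ y ]ℕ = if does (x ℕ.≟ y) then 1 else 0

-- number of arc endpoints at outer marked point k (loops count twice)
endsAt : ℕ → ℕ → Arc → ℕ
endsAt m k (bridge k' l) = [ k ≟ k' ]ℕ
endsAt m k (outer a d)   = [ k ≟ a ]ℕ ℕ.+ [ k ≟ modN (a ℕ.+ d) m ]ℕ
endsAt m k (inner c d)   = 0

-- number of triangles incident to outer marked point k
-- (= number of angles at k = 1 + number of arc ends at k)
outerQuiddity : ℕ → List Arc → ℕ → ℕ
outerQuiddity m T k = suc (sum (map (endsAt m k) T))

OuterFriezeHasQuiddity : ∀ {m} → List Arc → Vec ℕ m → Set
OuterFriezeHasQuiddity {m} T q = ∀ (k : Fin m) → outerQuiddity m T (toℕ k) ≡ lookup q k

-- Rotating the inner boundary component (with its marked points) by r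
-- steps (r ∈ ℤ; full turns are Dehn twists).

rotateInner : ℕ → ℤ → Arc → Arc
rotateInner n r (bridge k l) = bridge k (l ℤ.+ r)
rotateInner n r (outer a d)  = outer a d
rotateInner n r (inner c d)  = inner (modZ (+ c ℤ.+ r) n) d

SameUpToInnerRotation : ℕ → List Arc → List Arc → Set
SameUpToInnerRotation n T T' = Σ ℤ λ r → ∀ α → (α ∈ T' ⇔ rotateInner n r α ∈ T)

{-# OPTIONS --safe #-}
-- Lift to the universal cover of the annulus, a strip in which outer point k and inner point l
-- have the lifts k + t m and l + t n (t ∈ ℤ).  All arcs of a skeletal triangulation are
-- bridges, and two lifted bridges cross exactly when their ends are in opposite order, so
-- non-crossing says that the lifted bridges, read as a relation from outer to inner
-- positions, are monotone.
-- Maximality then fills every gap: the bridges at outer point k end at a run of q_k − 1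
-- consecutive inner lifts, and the last inner end at k is the first one at k + 1.  Going once
-- around gives n = Σ (q_k − 2), which is positive as q ≠ (2, …, 2), and the triangulation is
-- determined by where the first run starts, i.e. up to rotating the inner boundary.
-- Conversely these fans of bridges are skeletal triangulations.
module Submission where

open import Defs

module Annulus where

  open import Data.Nat as ℕ using (ℕ; zero; suc; z≤n; s≤s; _≤′_; ≤′-refl; ≤′-step)
  import Data.Nat.Properties as ℕₚ
  open import Data.Nat.DivMod using (m<n⇒m%n≡m)
  open import Data.Nat.ListAction using (sum)
  open import Data.Integer
    using (ℤ; +_; +[1+_]; -[1+_]; 0ℤ; 1ℤ; -1ℤ; _+_; _-_; -_; _*_; _≤_; _<_; +≤+; +<+; -<+; ∣_∣)
  import Data.Integer.Properties as ℤₚ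
  open import Data.Integer.Tactic.RingSolver using (solve-∀)
  open import Algebra.Bundles using (AbelianGroup)
  open import Algebra.Properties.Group (AbelianGroup.group ℤₚ.+-0-abelianGroup) using (∙-cancelˡ)
  open import Data.Fin as Fin using (toℕ)
  import Data.Fin.Properties as Finₚ
  open import Data.Vec using (Vec; []; _∷_; lookup)
  open import Data.List using (List; []; _∷_; length; map; upTo; concatMap; deduplicate)
  open import Data.List.Properties using (length-map; length-upTo)
  import Data.List.Extrema ℤₚ.≤-totalOrder as Extrema
  open import Data.List.Membership.Propositional using (_∈_; find; lose)
  open import Data.List.Membership.Propositional.Properties
    using (∈-map⁺; ∈-map⁻; ∈-upTo⁺; ∈-upTo⁻; ∈-concatMap⁺; ∈-concatMap⁻;
           ∈-deduplicate⁺; ∈-deduplicate⁻)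
  open import Data.List.Membership.Propositional.Properties.WithK using (unique∧set⇒bag)
  open import Data.List.Relation.Binary.BagAndSetEquality using (∼bag⇒↭)
  open import Data.List.Relation.Binary.Permutation.Propositional.Properties using (↭-length)
  open import Data.List.Relation.Unary.All as All using (All; []; _∷_)
  open import Data.List.Relation.Unary.AllPairs using ([]; _∷_)
  open import Data.List.Relation.Unary.Any using (here; there)
  open import Data.List.Relation.Unary.Unique.Propositional using (Unique)
  import Data.List.Relation.Unary.Unique.Propositional.Properties as Unique
  open import Data.List.Relation.Unary.Unique.DecPropositional.Properties using (deduplicate-!)
  open import Data.Empty using (⊥-elim)
  open import Data.Unit using (tt)
  open import Data.Product using (∃; ∃₂; _×_; _,_; proj₁; proj₂)
  open import Data.Sum using (inj₁; inj₂; [_,_]′)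
  open import Function using (id; _⇔_; mk⇔; Equivalence; case_of_)
  open import Relation.Binary.Definitions using (DecidableEquality)
  open import Relation.Binary.PropositionalEquality
  open import Relation.Nullary using (¬_; yes; no)
  open import Relation.Nullary.Decidable using (dec-true; dec-false; map′; _×-dec_)

  open Equivalence using (to; from)

  private variable
    a b l x y : ℤ
    j k : ℕ
    T : List Arc

  +-cancelˡ-≤ : ∀ c → c + x ≤ c + y → x ≤ y
  +-cancelˡ-≤ {x} {y} c le = subst₂ _≤_ (cancel c x) (cancel c y) (ℤₚ.+-monoʳ-≤ (- c) le)
    where
    cancel : ∀ c z → - c + (c + z) ≡ z
    cancel = solve-∀

  ≤⇒≡+ : a ≤ x → ∃ λ i → x ≡ a + + i
  ≤⇒≡+ {a} {x} a≤x = ∣ x - a ∣ , (begin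
    x               ≡⟨ restore a x ⟨
    a + (x - a)     ≡⟨ cong (_+_ a) (ℤₚ.0≤i⇒+∣i∣≡i (ℤₚ.i≤j⇒0≤j-i a≤x)) ⟨
    a + + ∣ x - a ∣ ∎)
    where
    open ≡-Reasoning
    restore : ∀ a x → a + (x - a) ≡ x
    restore = solve-∀

  a+t*M-t*M≡a : ∀ a t M → a + t * M - t * M ≡ a
  a+t*M-t*M≡a = solve-∀

  a+t′*M-t*M≡a+[t′-t]*M : ∀ a t t′ M → a + t′ * M - t * M ≡ a + (t′ - t) * M
  a+t′*M-t*M≡a+[t′-t]*M = solve-∀

  a-[1+a]≡-1 : ∀ a → a + -1ℤ * (1ℤ + a) ≡ -1ℤ
  a-[1+a]≡-1 = solve-∀

  N≤[1+u]*N : ∀ N u → + N ≤ + suc u * + N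
  N≤[1+u]*N N u = subst (+ N ≤_) (ℤₚ.pos-* (suc u) N) (+≤+ (ℕₚ.m≤m+n N (u ℕ.* N)))

  N≤a+[1+u]*N : ∀ N u → 0ℤ ≤ a → + N ≤ a + + suc u * + N
  N≤a+[1+u]*N N u 0≤a = ℤₚ.+-mono-≤ 0≤a (N≤[1+u]*N N u)

  a-[1+u]*N<0 : ∀ N u → a < + N → a + -[1+ u ] * + N < 0ℤ
  a-[1+u]*N<0 {a} N u a<N = begin-strict
    a + -[1+ u ] * + N  ≡⟨ cong (_+_ a) (ℤₚ.neg-distribˡ-* (+ suc u) (+ N)) ⟨
    a - + suc u * + N   ≤⟨ ℤₚ.+-monoʳ-≤ a (ℤₚ.neg-mono-≤ (N≤[1+u]*N N u)) ⟩
    a - + N             <⟨ ℤₚ.+-monoˡ-< (- + N) a<N ⟩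
    + N - + N           ≡⟨ ℤₚ.+-inverseʳ (+ N) ⟩
    0ℤ                  ∎
    where open ℤₚ.≤-Reasoning

  +k≡+k′+u*m⇒u≡0 : ∀ {m k k′} u → k ℕ.< m → k′ ℕ.< m → + k ≡ + k′ + u * + m → u ≡ 0ℤ
  +k≡+k′+u*m⇒u≡0 (+ zero)      _   _    _  = refl
  +k≡+k′+u*m⇒u≡0 {m} +[1+ v ]  k<m _    eq =
    ⊥-elim (ℤₚ.<⇒≱ (+<+ k<m) (subst (+ m ≤_) (sym eq) (N≤a+[1+u]*N m v (+≤+ z≤n))))
  +k≡+k′+u*m⇒u≡0 {m} -[1+ v ]  _   k′<m eq =
    ⊥-elim (ℤₚ.<⇒≱ (subst (_< 0ℤ) (sym eq) (a-[1+u]*N<0 m v (+<+ k′<m))) (+≤+ z≤n))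

  +k+t*m-injective : ∀ {m k k′} t t′ → k ℕ.< m → k′ ℕ.< m →
                     + k + t * + m ≡ + k′ + t′ * + m → k ≡ k′ × t ≡ t′
  +k+t*m-injective {m} {k} {k′} t t′ k<m k′<m eq =
    ℤₚ.+-injective k≡k′ , sym (ℤₚ.i-j≡0⇒i≡j t′ t t′-t≡0)
    where
    open ≡-Reasoning
    offset : + k ≡ + k′ + (t′ - t) * + m
    offset = begin
      + k                        ≡⟨ a+t*M-t*M≡a (+ k) t (+ m) ⟨
      + k + t * + m - t * + m    ≡⟨ cong (_- t * + m) eq ⟩
      + k′ + t′ * + m - t * + m  ≡⟨ a+t′*M-t*M≡a+[t′-t]*M (+ k′) t t′ (+ m) ⟩
      + k′ + (t′ - t) * + m      ∎
    t′-t≡0 : t′ - t ≡ 0ℤ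
    t′-t≡0 = +k≡+k′+u*m⇒u≡0 (t′ - t) k<m k′<m offset
    k≡k′ : + k ≡ + k′
    k≡k′ = trans offset (trans (cong (λ u → + k′ + u * + m) t′-t≡0) (ℤₚ.+-identityʳ (+ k′)))

  infix 4 _∈[_,_]
  _∈[_,_] : ℤ → ℤ → ℤ → Set
  x ∈[ a , b ] = a ≤ x × x ≤ b

  ∈[+]⇔∈[] : ∀ c → x ∈[ c + a , c + b ] ⇔ x - c ∈[ a , b ]
  ∈[+]⇔∈[] {x} {a} {b} c = mk⇔
    (λ (c+a≤x , x≤c+b) → subst (_≤ x - c) (cancel c a) (ℤₚ.+-monoˡ-≤ (- c) c+a≤x) ,
                         subst (x - c ≤_) (cancel c b) (ℤₚ.+-monoˡ-≤ (- c) x≤c+b))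
    (λ (a≤x-c , x-c≤b) → subst (c + a ≤_) (restore c x) (ℤₚ.+-monoʳ-≤ c a≤x-c) ,
                         subst (_≤ c + b) (restore c x) (ℤₚ.+-monoʳ-≤ c x-c≤b))
    where
    cancel : ∀ c a → c + a - c ≡ a
    cancel = solve-∀
    restore : ∀ c x → c + (x - c) ≡ x
    restore = solve-∀

  interval : ℤ → ℕ → List ℤ
  interval a j = map (λ i → a + + i) (upTo (suc j))

  ∈-interval⁻ : x ∈ interval a j → x ∈[ a , a + + j ]
  ∈-interval⁻ {a = a} x∈ with i , i∈ , refl ← ∈-map⁻ _ x∈ =
    ℤₚ.i≤i+j a (+ i) , ℤₚ.+-monoʳ-≤ a (+≤+ (ℕₚ.≤-pred (∈-upTo⁻ i∈)))

  ∈-interval⁺ : x ∈[ a , a + + j ] → x ∈ interval a j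
  ∈-interval⁺ {a = a} (a≤x , x≤a+j) with i , refl ← ≤⇒≡+ a≤x =
    ∈-map⁺ _ (∈-upTo⁺ (s≤s (ℤₚ.drop‿+≤+ (+-cancelˡ-≤ a x≤a+j))))

  interval-unique : ∀ a j → Unique (interval a j)
  interval-unique a j = Unique.map⁺ (λ eq → ℤₚ.+-injective (∙-cancelˡ a _ _ eq)) (Unique.upTo⁺ (suc j))

  length-interval : ∀ {xs} → Unique xs → (∀ {x} → x ∈ xs ⇔ x ∈[ a , a + + j ]) → length xs ≡ suc j
  length-interval {a} {j} {xs} unique xs⇔ = begin
    length xs              ≡⟨ ↭-length (∼bag⇒↭ (unique∧set⇒bag unique (interval-unique a j) same)) ⟩
    length (interval a j)  ≡⟨ length-map _ (upTo (suc j)) ⟩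
    length (upTo (suc j))  ≡⟨ length-upTo (suc j) ⟩
    suc j                  ∎
    where
    open ≡-Reasoning
    same : ∀ {x} → x ∈ xs ⇔ x ∈ interval a j
    same = mk⇔ (λ x∈ → ∈-interval⁺ (to xs⇔ x∈)) (λ x∈ → from xs⇔ (∈-interval⁻ x∈))

  min∈ : ∀ x xs → Extrema.min x xs ∈ x ∷ xs
  min∈ x xs = [ here , there ]′ (Extrema.argmin-sel id x xs)

  max∈ : ∀ x xs → Extrema.max x xs ∈ x ∷ xs
  max∈ x xs = [ here , there ]′ (Extrema.argmax-sel id x xs)

  ∈[min,max] : ∀ x xs → y ∈ x ∷ xs → y ∈[ Extrema.min x xs , Extrema.max x xs ]
  ∈[min,max] x xs (here refl) = Extrema.min≤⊤ x xs , Extrema.⊥≤max x xs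
  ∈[min,max] x xs (there y∈)  = All.lookup (Extrema.min≤xs x xs) y∈ , All.lookup (Extrema.xs≤max x xs) y∈

  innerEnds : ℕ → List Arc → List ℤ
  innerEnds k []                 = []
  innerEnds k (bridge k′ l ∷ T) with k ℕ.≟ k′
  ... | yes _ = l ∷ innerEnds k T
  ... | no _  = innerEnds k T
  innerEnds k (outer _ _ ∷ T)    = innerEnds k T
  innerEnds k (inner _ _ ∷ T)    = innerEnds k T

  ∈-innerEnds⁻ : ∀ T → l ∈ innerEnds k T → bridge k l ∈ T
  ∈-innerEnds⁻ {k = k} (bridge k′ _ ∷ T) l∈ with k ℕ.≟ k′
  ∈-innerEnds⁻ (bridge _ _ ∷ T) (here refl) | yes refl = here refl
  ∈-innerEnds⁻ (bridge _ _ ∷ T) (there l∈)  | yes refl = there (∈-innerEnds⁻ T l∈)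
  ∈-innerEnds⁻ (bridge _ _ ∷ T) l∈          | no _     = there (∈-innerEnds⁻ T l∈)
  ∈-innerEnds⁻ (outer _ _ ∷ T) l∈ = there (∈-innerEnds⁻ T l∈)
  ∈-innerEnds⁻ (inner _ _ ∷ T) l∈ = there (∈-innerEnds⁻ T l∈)

  ∈-innerEnds⁺ : ∀ T → bridge k l ∈ T → l ∈ innerEnds k T
  ∈-innerEnds⁺ {k = k} (bridge k′ _ ∷ T) b∈ with k ℕ.≟ k′
  ∈-innerEnds⁺ (bridge _ _ ∷ T) (here refl) | yes refl = here refl
  ∈-innerEnds⁺ (bridge _ _ ∷ T) (there b∈)  | yes refl = there (∈-innerEnds⁺ T b∈)
  ∈-innerEnds⁺ (bridge _ _ ∷ T) (here refl) | no k≢k   = ⊥-elim (k≢k refl)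
  ∈-innerEnds⁺ (bridge _ _ ∷ T) (there b∈)  | no _     = ∈-innerEnds⁺ T b∈
  ∈-innerEnds⁺ (outer _ _ ∷ T) (there b∈) = ∈-innerEnds⁺ T b∈
  ∈-innerEnds⁺ (inner _ _ ∷ T) (there b∈) = ∈-innerEnds⁺ T b∈

  innerEnds-unique : ∀ T → Unique T → Unique (innerEnds k T)
  innerEnds-unique [] [] = []
  innerEnds-unique {k = k} (bridge k′ _ ∷ T) (b∉ ∷ unique) with k ℕ.≟ k′
  ... | yes refl =
    All.tabulate (λ l′∈ l≡l′ → All.lookup b∉ (∈-innerEnds⁻ T l′∈) (cong (bridge k) l≡l′))
    ∷ innerEnds-unique T unique
  ... | no _     = innerEnds-unique T unique
  innerEnds-unique (outer _ _ ∷ T) (_ ∷ unique) = innerEnds-unique T unique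
  innerEnds-unique (inner _ _ ∷ T) (_ ∷ unique) = innerEnds-unique T unique

  indicator-yes : ∀ {k k′} → k ≡ k′ → [ k ≟ k′ ]ℕ ≡ 1
  indicator-yes {k} {k′} k≡k′ rewrite dec-true (k ℕ.≟ k′) k≡k′ = refl

  indicator-no : ∀ {k k′} → k ≢ k′ → [ k ≟ k′ ]ℕ ≡ 0
  indicator-no {k} {k′} k≢k′ rewrite dec-false (k ℕ.≟ k′) k≢k′ = refl

  outerQuiddity-bridging : ∀ {m} → All IsBridging T → outerQuiddity m T k ≡ suc (length (innerEnds k T))
  outerQuiddity-bridging {T} {k} {m} bridging = cong suc (ends bridging)
    where
    ends : ∀ {T} → All IsBridging T → sum (map (endsAt m k) T) ≡ length (innerEnds k T)
    ends [] = refl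
    ends {bridge k′ _ ∷ _} (_ ∷ bridging) with k ℕ.≟ k′
    ... | yes k≡k′ = cong₂ ℕ._+_ (indicator-yes k≡k′) (ends bridging)
    ... | no k≢k′  = cong₂ ℕ._+_ (indicator-no k≢k′) (ends bridging)

  OuterQuiddity≡2+ : ℕ → List Arc → (ℕ → ℕ) → Set
  OuterQuiddity≡2+ m T d = ∀ {k} → k ℕ.< m → outerQuiddity m T k ≡ 2 ℕ.+ d k

  outerQuiddity-interval : ∀ {m} → All IsBridging T → Unique T →
                           (∀ {l} → bridge k l ∈ T ⇔ l ∈[ a , a + + j ]) →
                           outerQuiddity m T k ≡ 2 ℕ.+ j
  outerQuiddity-interval {T} bridging unique ends⇔ =
    trans (outerQuiddity-bridging bridging)
          (cong suc (length-interval (innerEnds-unique T unique)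
                      (mk⇔ (λ l∈ → to ends⇔ (∈-innerEnds⁻ T l∈))
                           (λ l∈ → ∈-innerEnds⁺ T (from ends⇔ l∈)))))

  origin-lift : Arc → Lifted
  origin-lift (bridge k l) = br (+ k) l
  origin-lift (outer a d)  = op (+ a) (+ (a ℕ.+ d))
  origin-lift (inner c d)  = ip (+ c) (+ (c ℕ.+ d))

  lift-0ℤ : ∀ m n γ → lift m n 0ℤ γ ≡ origin-lift γ
  lift-0ℤ m n (bridge k l) = cong₂ br (ℤₚ.+-identityʳ (+ k)) (ℤₚ.+-identityʳ l)
  lift-0ℤ m n (outer a d)  = cong₂ op (ℤₚ.+-identityʳ (+ a)) (cong (λ a′ → + (a′ ℕ.+ d)) (ℕₚ.+-identityʳ a))
  lift-0ℤ m n (inner c d)  = cong₂ ip (ℤₚ.+-identityʳ (+ c)) (cong (λ c′ → + (c′ ℕ.+ d)) (ℕₚ.+-identityʳ c))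

  data Lift (m n : ℕ) (T : List Arc) : ℤ → ℤ → Set where
    bridge-lift : ∀ {k l} → bridge k l ∈ T → ∀ t → Lift m n T (+ k + t * + m) (l + t * + n)

  origin-bridge-lift : ∀ {m n} → bridge k l ∈ T → Lift m n T (+ k) l
  origin-bridge-lift {k} {l} b∈ =
    subst₂ (Lift _ _ _) (ℤₚ.+-identityʳ (+ k)) (ℤₚ.+-identityʳ l) (bridge-lift b∈ 0ℤ)

  next-period-lift : ∀ {m n} → bridge 0 l ∈ T → Lift m n T (+ m) (l + + n)
  next-period-lift {l} {m = m} {n} b∈ =
    subst₂ (Lift _ _ _) (cong (_+_ 0ℤ) (ℤₚ.*-identityˡ (+ m))) (cong (_+_ l) (ℤₚ.*-identityˡ (+ n)))
      (bridge-lift b∈ 1ℤ)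

  previous-period-lift : ∀ {m₁ n} → bridge m₁ l ∈ T → Lift (suc m₁) n T -1ℤ (l - + n)
  previous-period-lift {l} {m₁ = m₁} {n} b∈ =
    subst₂ (Lift _ _ _) (a-[1+a]≡-1 (+ m₁)) (cong (_+_ l) (ℤₚ.-1*i≡-i (+ n))) (bridge-lift b∈ -1ℤ)

  Avoids : ℕ → ℕ → List Arc → Arc → Set
  Avoids m n T γ = ∀ {α} → α ∈ T → ¬ Cross m n γ α

  NonCrossing : ℕ → ℕ → List Arc → Set
  NonCrossing m n T = ∀ {α β} → α ∈ T → β ∈ T → ¬ Cross m n α β

  LiftsAvoid : ℕ → ℕ → List Arc → Arc → Set
  LiftsAvoid m n T γ = ∀ {x y} → Lift m n T x y → ¬ CrossL (origin-lift γ) (br x y)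

  avoids⇒liftsAvoid : ∀ {m n γ} → Avoids m n T γ → LiftsAvoid m n T γ
  avoids⇒liftsAvoid {m = m} {n} {γ} avoids (bridge-lift b∈ t) crossing =
    avoids b∈ (t , subst (λ L → CrossL L _) (sym (lift-0ℤ m n γ)) crossing)

  liftsAvoid⇒avoids : ∀ {m n γ} → All IsBridging T → LiftsAvoid m n T γ → Avoids m n T γ
  liftsAvoid⇒avoids {m = m} {n} {γ} _        avoid {bridge _ _} b∈ (t , crossing) =
    avoid (bridge-lift b∈ t) (subst (λ L → CrossL L _) (lift-0ℤ m n γ) crossing)
  liftsAvoid⇒avoids                 bridging _     {outer _ _}  α∈ = ⊥-elim (All.lookup bridging α∈)
  liftsAvoid⇒avoids                 bridging _     {inner _ _}  α∈ = ⊥-elim (All.lookup bridging α∈)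

  Monotone : (ℤ → ℤ → Set) → Set
  Monotone P = ∀ {x y x′ y′} → P x y → P x′ y′ → x < x′ → y ≤ y′

  monotone⇒¬CrossL : ∀ {P x y x′ y′} → Monotone P → P x y → P x′ y′ →
                     ¬ CrossL (br x y) (br x′ y′)
  monotone⇒¬CrossL mono p p′ (inj₁ (x<x′ , y′<y)) = ℤₚ.<⇒≱ y′<y (mono p p′ x<x′)
  monotone⇒¬CrossL mono p p′ (inj₂ (x′<x , y<y′)) = ℤₚ.<⇒≱ y<y′ (mono p′ p x′<x)

  monotone⇒noncrossing : ∀ {m n} → All IsBridging T → Monotone (Lift m n T) → NonCrossing m n T
  monotone⇒noncrossing bridging mono {bridge _ _} α∈ =
    liftsAvoid⇒avoids bridging (monotone⇒¬CrossL mono (origin-bridge-lift α∈))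
  monotone⇒noncrossing bridging mono {outer _ _} α∈ = ⊥-elim (All.lookup bridging α∈)
  monotone⇒noncrossing bridging mono {inner _ _} α∈ = ⊥-elim (All.lookup bridging α∈)

  MonotoneFromOrigin : ℕ → ℕ → List Arc → Set
  MonotoneFromOrigin m n T = ∀ {k l k′ l′} t → bridge k l ∈ T → bridge k′ l′ ∈ T →
                             + k < + k′ + t * + m → l ≤ l′ + t * + n

  -- A deck transformation moves any pair of lifts to a pair whose first member is at t = 0.
  monotoneFromOrigin⇒monotone : ∀ {m n} → MonotoneFromOrigin m n T → Monotone (Lift m n T)
  monotoneFromOrigin⇒monotone {m = m} {n} mono
    (bridge-lift {k} {l} b∈ t) (bridge-lift {k′} {l′} b′∈ t′) x<x′ =
    subst (l + t * + n ≤_) (restore l′ t t′ (+ n))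
      (ℤₚ.+-monoˡ-≤ (t * + n)
        (mono (t′ - t) b∈ b′∈
          (subst₂ _<_ (a+t*M-t*M≡a (+ k) t (+ m)) (a+t′*M-t*M≡a+[t′-t]*M (+ k′) t t′ (+ m))
            (ℤₚ.+-monoˡ-< (- (t * + m)) x<x′))))
    where
    restore : ∀ a t t′ M → a + (t′ - t) * M + t * M ≡ a + t′ * M
    restore = solve-∀

  noncrossing⇒monotoneFromOrigin : ∀ {m n} → NonCrossing m n T → MonotoneFromOrigin m n T
  noncrossing⇒monotoneFromOrigin noncrossing t b∈ b′∈ k<x′ =
    ℤₚ.≮⇒≥ λ y′<l → avoids⇒liftsAvoid (noncrossing b∈) (bridge-lift b′∈ t) (inj₁ (k<x′ , y′<l))

  -- The fan triangulation

  _≟-Arc_ : DecidableEquality Arc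
  bridge k l ≟-Arc bridge k′ l′ =
    map′ (λ (p , q) → cong₂ bridge p q) (λ { refl → refl , refl }) (k ℕ.≟ k′ ×-dec l ℤₚ.≟ l′)
  outer a d  ≟-Arc outer a′ d′  =
    map′ (λ (p , q) → cong₂ outer p q) (λ { refl → refl , refl }) (a ℕ.≟ a′ ×-dec d ℕ.≟ d′)
  inner c d  ≟-Arc inner c′ d′  =
    map′ (λ (p , q) → cong₂ inner p q) (λ { refl → refl , refl }) (c ℕ.≟ c′ ×-dec d ℕ.≟ d′)
  bridge _ _ ≟-Arc outer _ _    = no λ ()
  bridge _ _ ≟-Arc inner _ _    = no λ ()
  outer _ _  ≟-Arc bridge _ _   = no λ ()
  outer _ _  ≟-Arc inner _ _    = no λ ()
  inner _ _  ≟-Arc bridge _ _   = no λ ()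
  inner _ _  ≟-Arc outer _ _    = no λ ()

  -- With d k = q_k − 2, outer point k is joined to the inner lifts s k, …, s (suc k).
  module Construction (m₁ : ℕ) (d : ℕ → ℕ) where

    m : ℕ
    m = suc m₁

    s : ℕ → ℕ
    s zero    = 0
    s (suc k) = s k ℕ.+ d k

    n : ℕ
    n = s m

    s-mono : ∀ {i j} → i ≤′ j → s i ℕ.≤ s j
    s-mono ≤′-refl        = ℕₚ.≤-refl
    s-mono (≤′-step i≤′j) = ℕₚ.≤-trans (s-mono i≤′j) (ℕₚ.m≤m+n _ _)

    s≤n : k ℕ.≤ m → s k ℕ.≤ n
    s≤n k≤m = s-mono (ℕₚ.≤⇒≤′ k≤m)

    d≤n : k ℕ.< m → d k ℕ.≤ n
    d≤n {k} k<m = ℕₚ.≤-trans (ℕₚ.m≤n+m (d k) (s k)) (s≤n k<m)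

    block-containing : ∀ j {y} → y ℕ.≤ s (suc j) →
                       ∃ λ k → k ℕ.≤ j × s k ℕ.≤ y × y ℕ.≤ s (suc k)
    block-containing zero        y≤ = 0 , z≤n , z≤n , y≤
    block-containing (suc j) {y} y≤ with y ℕ.≤? s (suc j)
    ... | yes y≤′ with k , k≤j , bounds ← block-containing j y≤′ =
      k , ℕₚ.m≤n⇒m≤1+n k≤j , bounds
    ... | no y≰   = suc j , ℕₚ.≤-refl , ℕₚ.<⇒≤ (ℕₚ.≰⇒> y≰) , y≤

    InBlock : ℕ → ℤ → Set
    InBlock k l = k ℕ.< m × l ∈[ + s k , + s (suc k) ]

    block : ℕ → List Arc
    block k = map (bridge k) (interval (+ s k) (d k))

    blocks : List Arc
    blocks = concatMap block (upTo m)

    canonical : List Arc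
    canonical = deduplicate _≟-Arc_ blocks

    ∈-canonical⁻ : ∀ {α} → α ∈ canonical → ∃₂ λ k l → α ≡ bridge k l × InBlock k l
    ∈-canonical⁻ α∈
      with k , k∈ , α∈block ←
             find (∈-concatMap⁻ block {upTo m} (∈-deduplicate⁻ _≟-Arc_ blocks α∈))
      with l , l∈ , refl ← ∈-map⁻ (bridge k) α∈block
      = k , l , refl , ∈-upTo⁻ k∈ , ∈-interval⁻ l∈

    bridge∈canonical⇔ : bridge k l ∈ canonical ⇔ InBlock k l
    bridge∈canonical⇔ = mk⇔
      (λ b∈ → case ∈-canonical⁻ b∈ of λ { (_ , _ , refl , inBlock) → inBlock })
      (λ (k<m , l∈) → ∈-deduplicate⁺ _≟-Arc_
        (∈-concatMap⁺ block (lose (∈-upTo⁺ k<m) (∈-map⁺ (bridge _) (∈-interval⁺ l∈)))))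

    canonical-bridging : All IsBridging canonical
    canonical-bridging = All.tabulate λ α∈ → case ∈-canonical⁻ α∈ of λ { (_ , _ , refl , _) → tt }

    canonical-valid : All (Valid m n) canonical
    canonical-valid = All.tabulate λ α∈ → case ∈-canonical⁻ α∈ of λ { (_ , _ , refl , k<m , _) → k<m }

    canonical-unique : Unique canonical
    canonical-unique = deduplicate-! _≟-Arc_ blocks

    canonical-outerQuiddity : OuterQuiddity≡2+ m canonical d
    canonical-outerQuiddity k<m = outerQuiddity-interval canonical-bridging canonical-unique
      (mk⇔ (λ b∈ → proj₂ (to bridge∈canonical⇔ b∈)) (λ l∈ → from bridge∈canonical⇔ (k<m , l∈)))

    block-lift : InBlock k l → Lift m n canonical (+ k) l
    block-lift inBlock = origin-bridge-lift (from bridge∈canonical⇔ inBlock)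

    corner-lift : k ℕ.≤ m → Lift m n canonical (+ k) (+ s k)
    corner-lift k≤m with ℕₚ.m≤n⇒m<n∨m≡n k≤m
    ... | inj₁ k<m  = block-lift (k<m , ℤₚ.≤-refl , +≤+ (ℕₚ.m≤m+n _ _))
    ... | inj₂ refl = next-period-lift (from bridge∈canonical⇔ (s≤s z≤n , ℤₚ.≤-refl , +≤+ z≤n))

    lift-left-of : ∀ k → k ℕ.< m → ∃ λ x → x < + k × Lift m n canonical x (+ s k)
    lift-left-of zero    _   =
      -1ℤ , -<+ , subst (Lift m n canonical -1ℤ) (ℤₚ.+-inverseʳ (+ n))
                    (previous-period-lift
                      (from bridge∈canonical⇔ (ℕₚ.≤-refl , +≤+ (s≤n (ℕₚ.n≤1+n m₁)) , ℤₚ.≤-refl)))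
    lift-left-of (suc k) k<m =
      + k , +<+ ℕₚ.≤-refl , block-lift (ℕₚ.<⇒≤ k<m , +≤+ (ℕₚ.m≤m+n _ _) , ℤₚ.≤-refl)

    canonical-monotoneFromOrigin : MonotoneFromOrigin m n canonical
    canonical-monotoneFromOrigin {k} {l} {k′} {l′} t b∈ b′∈ k<x′
      with k<m , _ , l≤sk₁ ← to bridge∈canonical⇔ b∈
         | k′<m , sk′≤l′ , _ ← to bridge∈canonical⇔ b′∈
      with t
    ... | + zero = begin
      l            ≤⟨ l≤sk₁ ⟩
      + s (suc k)  ≤⟨ +≤+ (s-mono (ℕₚ.≤⇒≤′ k<k′)) ⟩
      + s k′       ≤⟨ sk′≤l′ ⟩
      l′           ≡⟨ ℤₚ.+-identityʳ l′ ⟨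
      l′ + 0ℤ      ∎
      where
      open ℤₚ.≤-Reasoning
      k<k′ : k ℕ.< k′
      k<k′ = ℤₚ.drop‿+<+ (subst (+ k <_) (ℤₚ.+-identityʳ (+ k′)) k<x′)
    ... | +[1+ u ] = begin
      l                   ≤⟨ l≤sk₁ ⟩
      + s (suc k)         ≤⟨ +≤+ (s≤n k<m) ⟩
      + n                 ≤⟨ N≤a+[1+u]*N n u (ℤₚ.≤-trans (+≤+ z≤n) sk′≤l′) ⟩
      l′ + + suc u * + n  ∎
      where open ℤₚ.≤-Reasoning
    ... | -[1+ u ] =
      ⊥-elim (ℤₚ.<⇒≱ (ℤₚ.<-trans k<x′ (a-[1+u]*N<0 m u (+<+ k′<m))) (+≤+ z≤n))

    canonical-noncrossing : NonCrossing m n canonical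
    canonical-noncrossing =
      monotone⇒noncrossing canonical-bridging (monotoneFromOrigin⇒monotone canonical-monotoneFromOrigin)

    canonical-maximal : ∀ γ → Valid m n γ → Avoids m n canonical γ → γ ∈ canonical
    canonical-maximal γ valid avoids = maximal γ valid (avoids⇒liftsAvoid avoids)
      where
      1+a<a+d : ∀ a {d} → 2 ℕ.≤ d → + suc a < + (a ℕ.+ d)
      1+a<a+d a {d} 2≤d = +<+ (subst (ℕ._< a ℕ.+ d) (ℕₚ.+-comm a 1) (ℕₚ.+-monoʳ-< a 2≤d))
      maximal : ∀ γ → Valid m n γ → LiftsAvoid m n canonical γ → γ ∈ canonical
      maximal (bridge k l) k<m avoid with + s k ℤₚ.≤? l | l ℤₚ.≤? + s (suc k)
      ... | yes sk≤l | yes l≤sk₁ = from bridge∈canonical⇔ (k<m , sk≤l , l≤sk₁)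
      ... | no sk≰l  | _ with x , x<k , lift ← lift-left-of k k<m =
        ⊥-elim (avoid lift (inj₂ (x<k , ℤₚ.≰⇒> sk≰l)))
      ... | _ | no l≰sk₁ = ⊥-elim (avoid (corner-lift k<m) (inj₁ (+<+ ℕₚ.≤-refl , ℤₚ.≰⇒> l≰sk₁)))
      maximal (outer a d) (a<m , 2≤d , _) avoid =
        ⊥-elim (avoid (corner-lift a<m) (+<+ ℕₚ.≤-refl , 1+a<a+d a 2≤d))
      maximal (inner c d) (c<n , 2≤d , _) avoid with k , k≤m₁ , sk≤ , ≤sk₁ ← block-containing m₁ c<n =
        ⊥-elim (avoid (block-lift (s≤s k≤m₁ , +≤+ sk≤ , +≤+ ≤sk₁)) (+<+ ℕₚ.≤-refl , 1+a<a+d c 2≤d))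

    canonical-triangulation : IsTriangulation m n canonical
    canonical-triangulation = record
      { valid       = canonical-valid
      ; unique      = canonical-unique
      ; noncrossing = canonical-noncrossing
      ; maximal     = canonical-maximal
      }

  -- Every skeletal triangulation with the same outer quiddities is a rotated fan

  module Uniqueness (m₁ : ℕ) (d : ℕ → ℕ) {n′ : ℕ} {T : List Arc}
    (triangulation : IsTriangulation (suc m₁) n′ T) (bridging : All IsBridging T)
    (quiddity : OuterQuiddity≡2+ (suc m₁) T d) where

    open Construction m₁ d
    open IsTriangulation triangulation

    monotone : Monotone (Lift m n′ T)
    monotone = monotoneFromOrigin⇒monotone (noncrossing⇒monotoneFromOrigin noncrossing)

    lift-in-column : ∀ t → Lift m n′ T x y → x ≡ + k + t * + m → k ℕ.< m →
                     ∃ λ l → bridge k l ∈ T × y ≡ l + t * + n′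
    lift-in-column t (bridge-lift {l = l} b∈ t′) x≡ k<m
      with refl , refl ← +k+t*m-injective t t′ k<m (All.lookup valid b∈) (sym x≡) = l , b∈ , refl

    lift-at-origin : Lift m n′ T (+ k) y → k ℕ.< m → bridge k y ∈ T
    lift-at-origin {k} lift k<m
      with l , b∈ , refl ← lift-in-column 0ℤ lift (sym (ℤₚ.+-identityʳ (+ k))) k<m =
      subst (λ l′ → bridge k l′ ∈ T) (sym (ℤₚ.+-identityʳ l)) b∈

    bridge-between : k ℕ.< m → (∀ {x y} → Lift m n′ T x y → + k < x → l ≤ y) →
                                (∀ {x y} → Lift m n′ T x y → x < + k → y ≤ l) → bridge k l ∈ T
    bridge-between {k} {l} k<m right left = maximal (bridge k l) k<m (liftsAvoid⇒avoids bridging avoid)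
      where
      avoid : LiftsAvoid m n′ T (bridge k l)
      avoid lift (inj₁ (k<x , y<l)) = ℤₚ.<⇒≱ y<l (right lift k<x)
      avoid lift (inj₂ (x<k , l<y)) = ℤₚ.<⇒≱ l<y (left lift x<k)

    convex : k ℕ.< m → bridge k a ∈ T → bridge k b ∈ T → l ∈[ a , b ] → bridge k l ∈ T
    convex k<m a∈ b∈ (a≤l , l≤b) = bridge-between k<m
      (λ lift k<x → ℤₚ.≤-trans l≤b (monotone (origin-bridge-lift b∈) lift k<x))
      (λ lift x<k → ℤₚ.≤-trans (monotone lift (origin-bridge-lift a∈) x<k) a≤l)

    -- Nothing can separate the last bridge at X from the outer point just right of X,
    -- so by maximality that point is joined to the same inner end.
    next-bridge : ∀ {X} → k ℕ.< m → 1ℤ + X ≡ + k → Lift m n′ T X b →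
                  (∀ {y} → Lift m n′ T X y → y ≤ b) → bridge k b ∈ T
    next-bridge {k} {b} {X} k<m 1+X≡k top below = bridge-between k<m
      (λ lift k<x → monotone top lift (ℤₚ.<-trans X<k k<x))
      left
      where
      X<k : X < + k
      X<k = ℤₚ.suc[i]≤j⇒i<j (ℤₚ.≤-reflexive 1+X≡k)
      left : ∀ {x y} → Lift m n′ T x y → x < + k → y ≤ b
      left {x} lift x<k with x ℤₚ.≟ X
      ... | yes refl = below lift
      ... | no x≢X   = monotone lift top
                         (ℤₚ.≤∧≢⇒< (+-cancelˡ-≤ 1ℤ (subst (1ℤ + x ≤_) (sym 1+X≡k) (ℤₚ.i<j⇒suc[i]≤j x<k)))
                                   x≢X)

    Column : ℕ → ℤ → ℤ → Set
    Column k a b = ∀ {l} → bridge k l ∈ T ⇔ l ∈[ a , b ]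

    column-hull : k ℕ.< m → ∃₂ λ a b → a ≤ b × Column k a b
    -- The abstracted length equation is what excludes innerEnds k T = [].
    column-hull {k} k<m
      with innerEnds k T | ℕₚ.suc-injective (trans (sym (outerQuiddity-bridging bridging)) (quiddity k<m))
         | (λ {l} → ∈-innerEnds⁻ {l = l} {k = k} T) | (λ {l} → ∈-innerEnds⁺ {k = k} {l = l} T)
    ... | x ∷ xs | _ | ends⊆T | T⊆ends =
      Extrema.min x xs , Extrema.max x xs , ℤₚ.≤-trans (Extrema.min≤⊤ x xs) (Extrema.⊥≤max x xs) ,
      mk⇔ (λ b∈ → ∈[min,max] x xs (T⊆ends b∈))
          (convex k<m (ends⊆T (min∈ x xs)) (ends⊆T (max∈ x xs)))

    column : k ℕ.< m → ∃ λ a → Column k a (a + + d k)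
    column {k} k<m with a , b , a≤b , hull ← column-hull k<m with j , refl ← ≤⇒≡+ a≤b =
      a , subst (λ j → Column k a (a + + j)) j≡d hull
      where
      j≡d : j ≡ d k
      j≡d = ℕₚ.+-cancelˡ-≡ 2 _ _ (trans (sym (outerQuiddity-interval bridging unique hull)) (quiddity k<m))

    module Chain (a₀ : ℤ) (column₀ : Column 0 a₀ (a₀ + + d 0)) where

      chain : k ℕ.< m → Column k (a₀ + + s k) (a₀ + + s (suc k))
      chain {zero}  _ = subst (λ a → Column 0 a (a₀ + + d 0)) (sym (ℤₚ.+-identityʳ a₀)) column₀
      chain {suc k} k+1<m with a′ , column′ ← column k+1<m =
        subst₂ (Column (suc k)) a′≡top (trans (cong (_+ + d (suc k)) a′≡top) (ℤₚ.+-assoc a₀ _ _))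
          column′
        where
        k<m : k ℕ.< m
        k<m = ℕₚ.<⇒≤ k+1<m
        top : ℤ
        top = a₀ + + s (suc k)
        top∈ : bridge k top ∈ T
        top∈ = from (chain k<m) (ℤₚ.+-monoʳ-≤ a₀ (+≤+ (ℕₚ.m≤m+n _ _)) , ℤₚ.≤-refl)
        a′∈ : bridge (suc k) a′ ∈ T
        a′∈ = from column′ (ℤₚ.≤-refl , ℤₚ.i≤i+j a′ _)
        top∈next : bridge (suc k) top ∈ T
        top∈next = next-bridge k+1<m refl (origin-bridge-lift top∈)
                     (λ lift → proj₂ (to (chain k<m) (lift-at-origin lift k<m)))
        a′≡top : a′ ≡ top
        a′≡top = ℤₚ.≤-antisym (proj₁ (to column′ top∈next))
                              (monotone (origin-bridge-lift top∈) (origin-bridge-lift a′∈) (+<+ ℕₚ.≤-refl))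

      last-top∈ : bridge m₁ (a₀ + + n) ∈ T
      last-top∈ = from (chain ℕₚ.≤-refl) (ℤₚ.+-monoʳ-≤ a₀ (+≤+ (ℕₚ.m≤m+n _ _)) , ℤₚ.≤-refl)

      first-bottom∈ : bridge 0 a₀ ∈ T
      first-bottom∈ = from column₀ (ℤₚ.≤-refl , ℤₚ.i≤i+j a₀ _)

      n≤n′ : n ℕ.≤ n′
      n≤n′ = ℤₚ.drop‿+≤+ (+-cancelˡ-≤ a₀
               (monotone (origin-bridge-lift last-top∈) (next-period-lift first-bottom∈) (+<+ ℕₚ.≤-refl)))

      n′≤n : n′ ℕ.≤ n
      n′≤n = ℤₚ.drop‿+≤+ (+-cancelˡ-≤ a₀
               (subst (a₀ + + n′ ≤_) (restore a₀ (+ n) (+ n′)) (ℤₚ.+-monoˡ-≤ (+ n′) a₀≤w)))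
        where
        restore : ∀ a b c → a + b - c + c ≡ a + b
        restore = solve-∀
        w : ℤ
        w = a₀ + + n - + n′
        below : ∀ {y} → Lift m n′ T -1ℤ y → y ≤ w
        below lift with l , l∈ , refl ← lift-in-column -1ℤ lift (sym (a-[1+a]≡-1 (+ m₁))) ℕₚ.≤-refl =
          subst (_≤ w) (cong (_+_ l) (sym (ℤₚ.-1*i≡-i (+ n′))))
                (ℤₚ.+-monoˡ-≤ (- + n′) (proj₂ (to (chain ℕₚ.≤-refl) l∈)))
        a₀≤w : a₀ ≤ w
        a₀≤w = proj₁ (to column₀ (next-bridge (s≤s z≤n) refl (previous-period-lift last-top∈) below))

      rotation : ∀ α → α ∈ T ⇔ rotateInner n (- a₀) α ∈ canonical
      rotation (bridge k l) = mk⇔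
        (λ b∈ → let k<m = All.lookup valid b∈ in
          from bridge∈canonical⇔ (k<m , to (∈[+]⇔∈[] a₀) (to (chain k<m) b∈)))
        (λ b∈ → let k<m , l-a₀∈ = to bridge∈canonical⇔ b∈ in
          from (chain k<m) (from (∈[+]⇔∈[] a₀) l-a₀∈))
      rotation (outer _ _) =
        mk⇔ (λ α∈ → ⊥-elim (All.lookup bridging α∈)) (λ α∈ → ⊥-elim (All.lookup canonical-bridging α∈))
      rotation (inner _ _) =
        mk⇔ (λ α∈ → ⊥-elim (All.lookup bridging α∈)) (λ α∈ → ⊥-elim (All.lookup canonical-bridging α∈))

    sameUpToInnerRotation : n′ ≡ n × SameUpToInnerRotation n canonical T
    sameUpToInnerRotation with a₀ , column₀ ← column (s≤s z≤n) =
      ℕₚ.≤-antisym n′≤n n≤n′ , - a₀ , rotation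
      where open Chain a₀ column₀

  -- Skeletal quiddity sequences

  entry : ∀ {m} → Vec ℕ m → ℕ → ℕ
  entry []       _       = 0
  entry (x ∷ _)  zero    = x
  entry (_ ∷ xs) (suc k) = entry xs k

  entry-toℕ : ∀ {m} (q : Vec ℕ m) i → entry q (toℕ i) ≡ lookup q i
  entry-toℕ (_ ∷ _)  Fin.zero    = refl
  entry-toℕ (_ ∷ xs) (Fin.suc i) = entry-toℕ xs i

  periodic-toℕ : ∀ {m₁} (q : Vec ℕ (suc m₁)) i → periodic q (+ toℕ i) ≡ + lookup q i
  periodic-toℕ q i = cong (λ j → + lookup q j)
    (trans (Finₚ.fromℕ<-cong _ _ (m<n⇒m%n≡m (Finₚ.toℕ<n i)) _ (Finₚ.toℕ<n i))
           (Finₚ.fromℕ<-toℕ i (Finₚ.toℕ<n i)))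

  module FromQuiddity {m₁} (q : Vec ℕ (suc m₁)) (skeletal : IsSkeletalQuiddity q) where

    open IsInfiniteFrieze (proj₁ skeletal)

    2≤lookup : ∀ i → 2 ℕ.≤ lookup q i
    2≤lookup i =
      at-least-2 (ℤₚ.drop‿+<+ (subst (0ℤ <_) (trans (row2 _) (periodic-toℕ q i)) (positive (+ toℕ i) 0)))
                 (proj₁ (proj₂ skeletal) i)
      where
      at-least-2 : ∀ {x} → 0 ℕ.< x → x ≢ 1 → 2 ℕ.≤ x
      at-least-2 {suc zero}    _ x≢1 = ⊥-elim (x≢1 refl)
      at-least-2 {suc (suc _)} _ _   = s≤s (s≤s z≤n)

    d : ℕ → ℕ
    d k = entry q k ℕ.∸ 2

    lookup≡2+d : ∀ i → lookup q i ≡ 2 ℕ.+ d (toℕ i)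
    lookup≡2+d i =
      sym (trans (cong (λ e → 2 ℕ.+ (e ℕ.∸ 2)) (entry-toℕ q i)) (ℕₚ.m+[n∸m]≡n (2≤lookup i)))

    open Construction m₁ d using (n; d≤n)

    1≤n : 1 ℕ.≤ n
    1≤n
      with i , qᵢ≢2 ← Finₚ.¬∀⟶∃¬ _ (λ i → lookup q i ≡ 2) (λ i → lookup q i ℕ.≟ 2) (proj₂ (proj₂ skeletal)) =
      ℕₚ.≤-trans (ℕₚ.n≢0⇒n>0 λ dᵢ≡0 → qᵢ≢2 (trans (lookup≡2+d i) (cong (2 ℕ.+_) dᵢ≡0)))
                 (d≤n {toℕ i} (Finₚ.toℕ<n i))

    hasQuiddity⇔ : OuterFriezeHasQuiddity T q ⇔ OuterQuiddity≡2+ (suc m₁) T d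
    hasQuiddity⇔ {T} = mk⇔ atℕ atFin
      where
      atℕ : OuterFriezeHasQuiddity T q → OuterQuiddity≡2+ (suc m₁) T d
      atℕ hasQ k<m = subst (λ j → outerQuiddity (suc m₁) T j ≡ 2 ℕ.+ d j) (Finₚ.toℕ-fromℕ< k<m)
                       (trans (hasQ (Fin.fromℕ< k<m)) (lookup≡2+d _))
      atFin : OuterQuiddity≡2+ (suc m₁) T d → OuterFriezeHasQuiddity T q
      atFin quid i = trans (quid (Finₚ.toℕ<n i)) (sym (lookup≡2+d i))

open import Data.Nat using (ℕ; zero; suc; _≤_)
open import Data.Vec using (Vec)
open import Data.List using (List)
open import Data.Product using (Σ; _×_; _,_)
open import Data.Empty using (⊥-elim)
open import Function using (Equivalence)
open import Relation.Binary.PropositionalEquality using (_≡_)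
open Annulus

proposition3p10 : ∀ (m : ℕ) (q : Vec ℕ m) → IsSkeletalQuiddity q →
    Σ ℕ λ n → 1 ≤ n × Σ (List Arc) λ T →
      IsSkeletalTriangulation m n T × OuterFriezeHasQuiddity T q ×
      (∀ (n' : ℕ) (T' : List Arc) → 1 ≤ n' → IsSkeletalTriangulation m n' T' →
        OuterFriezeHasQuiddity T' q → n' ≡ n × SameUpToInnerRotation n T T')
proposition3p10 zero     q (_ , _ , not-all-2) = ⊥-elim (not-all-2 λ ())
proposition3p10 (suc m₁) q skeletal =
  n , 1≤n , canonical , (canonical-triangulation , canonical-bridging) ,
  Equivalence.from (hasQuiddity⇔ {canonical}) canonical-outerQuiddity ,
  λ _ T′ _ (triangulation′ , bridging′) hasQuiddity′ →
    Uniqueness.sameUpToInnerRotation m₁ d triangulation′ bridging′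
      (Equivalence.to (hasQuiddity⇔ {T′}) hasQuiddity′)
  where
  open FromQuiddity q skeletal
  open Construction m₁ d
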